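{- Let $\mathcal{F}$ be the set of formulas built from a countably infinite set $P$ of propositional variables using $\neg$ (unary) and $\wedge,\vee$ (binary), and let $\mathrm{BD}=(\mathcal{F},\vdash)$ be Belnap-Dunn logic as described in the context. Then for all $A_1,A_2\in\mathcal{F}$: $A_1$ and $A_2$ are synonymous in $\mathrm{BD}$ if and only if $\nu(A_1)=\nu(A_2)$ for every valuation $\nu$ in the Belnap-Dunn matrix.
   Context: The Belnap-Dunn matrix is $M=(V,D,I)$ with $V=\{t,f,b,n\}$, designated values $D=\{t,b\}$, and, with $\le$ the partial order on $V$ having least element $f$, greatest element $t$, and $b,n$ incomparable: $I(\neg)$ swaps $t$ and $f$ and fixes $b$ and $n$; $I(\wedge)(a_1,a_2)=\inf\{a_1,a_2\}$; $I(\vee)(a_1,a_2)=\sup\{a_1,a_2\}$. A valuation is a map $\nu:\mathcal{F}\to V$ compatible with these operations (arbitrary on variables). For sets of formulas $\Gamma,\Delta$, $\Gamma\vdash\Delta$ iff every valuation that gives all formulas of $\Gamma$ a designated value gives some formula of $\Delta$ a designated value. Synonymity: $A_1$ and $A_2$ are synonymous in $\mathrm{BD}$ iff for all formulas $B_1,B_2$ such that $B_2$ is obtained from $B_1$ by replacing some or all occurrences of $A_1$ by $A_2$, both $\{B_1\}\vdash\{B_2\}$ and $\{B_2\}\vdash\{B_1\}$. -}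

module Defs where

open import Data.Nat using (ℕ)
open import Data.Product using (_×_; ∃)
open import Relation.Binary.PropositionalEquality using (_≡_)

Var : Set
Var = ℕ

data Formula : Set where
  var  : Var → Formula
  ¬'_  : Formula → Formula
  _∧'_ : Formula → Formula → Formula
  _∨'_ : Formula → Formula → Formula

data V : Set where
  t f b n : V

data Designated : V → Set where
  des-t : Designated t
  des-b : Designated b

I¬ : V → V
I¬ t = f
I¬ f = t
I¬ b = b
I¬ n = n

-- Infimum w.r.t. the order f ≤ b, n ≤ t with b, n incomparable.
I∧ : V → V → V
I∧ t y = y
I∧ f y = f
I∧ b t = b
I∧ b f = f
I∧ b b = b
I∧ b n = f
I∧ n t = n
I∧ n f = f
I∧ n b = f
I∧ n n = n

-- Supremum w.r.t. the same order.
I∨ : V → V → V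
I∨ t y = t
I∨ f y = y
I∨ b t = t
I∨ b f = b
I∨ b b = b
I∨ b n = t
I∨ n t = t
I∨ n f = n
I∨ n b = t
I∨ n n = n

record Valuation : Set where
  field
    val   : Formula → V
    val-¬ : ∀ A → val (¬' A) ≡ I¬ (val A)
    val-∧ : ∀ A B → val (A ∧' B) ≡ I∧ (val A) (val B)
    val-∨ : ∀ A B → val (A ∨' B) ≡ I∨ (val A) (val B)
open Valuation public

FSet : Set₁
FSet = Formula → Set

_⊢_ : FSet → FSet → Set
Γ ⊢ Δ = (ν : Valuation) → (∀ A → Γ A → Designated (val ν A))
        → ∃ λ B → Δ B × Designated (val ν B)

⟦_⟧ : Formula → FSet
⟦ A ⟧ B = B ≡ A

-- Replace A₁ A₂ B₁ B₂: B₂ is obtained from B₁ by replacing some (possibly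
-- none, or all) occurrences of A₁ by A₂.
data Replace (A₁ A₂ : Formula) : Formula → Formula → Set where
  rep-here : Replace A₁ A₂ A₁ A₂
  rep-var  : ∀ x → Replace A₁ A₂ (var x) (var x)
  rep-¬    : ∀ {B C} → Replace A₁ A₂ B C → Replace A₁ A₂ (¬' B) (¬' C)
  rep-∧    : ∀ {B B' C C'} → Replace A₁ A₂ B C → Replace A₁ A₂ B' C'
             → Replace A₁ A₂ (B ∧' B') (C ∧' C')
  rep-∨    : ∀ {B B' C C'} → Replace A₁ A₂ B C → Replace A₁ A₂ B' C'
             → Replace A₁ A₂ (B ∨' B') (C ∨' C')

Synonymous : Formula → Formula → Set
Synonymous A₁ A₂ = ∀ B₁ B₂ → Replace A₁ A₂ B₁ B₂
                   → (⟦ B₁ ⟧ ⊢ ⟦ B₂ ⟧) × (⟦ B₂ ⟧ ⊢ ⟦ B₁ ⟧)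

-- The four values of the Belnap-Dunn matrix are told apart by designation
-- together with designation of their negation: t is designated and t̄ = f is
-- not, b and b̄ = b both are, n and n̄ = n are neither, f is not but f̄ = t is.
-- Synonymous formulas are mutually derivable in every context, in particular
-- as themselves and under ¬, so every valuation gives them the same value.
-- Conversely, valuations are compositional, so replacing a subformula by one
-- of equal value never changes the value of the whole formula.
module Submission where

open import Data.Product using (_×_; _,_)
open import Function.Bundles using (_⇔_; mk⇔; Equivalence)
open import Relation.Binary.PropositionalEquality
  using (_≡_; refl; cong; cong₂; subst₂; module ≡-Reasoning)
open import Relation.Nullary using (¬_; contradiction)

open import Defs

open Equivalence using (to; from)

f-undesignated : ¬ Designated f
f-undesignated ()

n-undesignated : ¬ Designated n
n-undesignated ()

Designated-cong : ∀ {x y} → x ≡ y → Designated x ⇔ Designated y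
Designated-cong refl = mk⇔ (λ d → d) (λ d → d)

≡-from-designation : ∀ {x y} → (Designated x ⇔ Designated y)
                   → (Designated (I¬ x) ⇔ Designated (I¬ y)) → x ≡ y
≡-from-designation {t} {t} p q = refl
≡-from-designation {f} {f} p q = refl
≡-from-designation {b} {b} p q = refl
≡-from-designation {n} {n} p q = refl
≡-from-designation {t} {f} p q = contradiction (to p des-t) f-undesignated
≡-from-designation {t} {b} p q = contradiction (from q des-b) f-undesignated
≡-from-designation {t} {n} p q = contradiction (to p des-t) n-undesignated
≡-from-designation {f} {t} p q = contradiction (from p des-t) f-undesignated
≡-from-designation {f} {b} p q = contradiction (from p des-b) f-undesignated
≡-from-designation {f} {n} p q = contradiction (to q des-t) n-undesignated
≡-from-designation {b} {t} p q = contradiction (to q des-b) f-undesignated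
≡-from-designation {b} {f} p q = contradiction (to p des-b) f-undesignated
≡-from-designation {b} {n} p q = contradiction (to p des-b) n-undesignated
≡-from-designation {n} {t} p q = contradiction (from p des-t) n-undesignated
≡-from-designation {n} {f} p q = contradiction (from q des-t) n-undesignated
≡-from-designation {n} {b} p q = contradiction (from p des-b) n-undesignated

⊢-mutual⇔designation : ∀ {A B} →
  ((⟦ A ⟧ ⊢ ⟦ B ⟧) × (⟦ B ⟧ ⊢ ⟦ A ⟧))
  ⇔ (∀ ν → Designated (val ν A) ⇔ Designated (val ν B))
⊢-mutual⇔designation {A} {B} =
  mk⇔ (λ (A⊢B , B⊢A) ν → mk⇔ (transfer A⊢B ν) (transfer B⊢A ν))
      (λ same → preserve (λ ν → to (same ν)) , preserve (λ ν → from (same ν)))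
  where
  transfer : ∀ {C D} → ⟦ C ⟧ ⊢ ⟦ D ⟧ → ∀ ν → Designated (val ν C) → Designated (val ν D)
  transfer C⊢D ν d with C⊢D ν (λ { _ refl → d })
  ... | _ , refl , d′ = d′

  preserve : ∀ {C D} → (∀ ν → Designated (val ν C) → Designated (val ν D)) → ⟦ C ⟧ ⊢ ⟦ D ⟧
  preserve {C} {D} g ν hyp = D , refl , g ν (hyp C refl)

val-replace : ∀ ν {A₁ A₂ B₁ B₂} → val ν A₁ ≡ val ν A₂
            → Replace A₁ A₂ B₁ B₂ → val ν B₁ ≡ val ν B₂
val-replace ν e rep-here    = e
val-replace ν e (rep-var x) = refl
val-replace ν e (rep-¬ {B} {C} r) = begin
  val ν (¬' B)     ≡⟨ val-¬ ν B ⟩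
  I¬ (val ν B)     ≡⟨ cong I¬ (val-replace ν e r) ⟩
  I¬ (val ν C)     ≡⟨ val-¬ ν C ⟨
  val ν (¬' C)     ∎
  where open ≡-Reasoning
val-replace ν e (rep-∧ {B} {B′} {C} {C′} r r′) = begin
  val ν (B ∧' B′)            ≡⟨ val-∧ ν B B′ ⟩
  I∧ (val ν B) (val ν B′)    ≡⟨ cong₂ I∧ (val-replace ν e r) (val-replace ν e r′) ⟩
  I∧ (val ν C) (val ν C′)    ≡⟨ val-∧ ν C C′ ⟨
  val ν (C ∧' C′)            ∎
  where open ≡-Reasoning
val-replace ν e (rep-∨ {B} {B′} {C} {C′} r r′) = begin
  val ν (B ∨' B′)            ≡⟨ val-∨ ν B B′ ⟩
  I∨ (val ν B) (val ν B′)    ≡⟨ cong₂ I∨ (val-replace ν e r) (val-replace ν e r′) ⟩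
  I∨ (val ν C) (val ν C′)    ≡⟨ val-∨ ν C C′ ⟨
  val ν (C ∨' C′)            ∎
  where open ≡-Reasoning

theorem5 : (A₁ A₂ : Formula) → Synonymous A₁ A₂ ⇔ ((ν : Valuation) → val ν A₁ ≡ val ν A₂)
theorem5 A₁ A₂ = mk⇔ same-value synonymous
  where
  same-value : Synonymous A₁ A₂ → (ν : Valuation) → val ν A₁ ≡ val ν A₂
  same-value syn ν = ≡-from-designation (designation rep-here) negated
    where
    designation : ∀ {B₁ B₂} → Replace A₁ A₂ B₁ B₂
                → Designated (val ν B₁) ⇔ Designated (val ν B₂)
    designation r = to ⊢-mutual⇔designation (syn _ _ r) ν

    negated : Designated (I¬ (val ν A₁)) ⇔ Designated (I¬ (val ν A₂))
    negated = subst₂ (λ x y → Designated x ⇔ Designated y)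
                     (val-¬ ν A₁) (val-¬ ν A₂) (designation (rep-¬ rep-here))

  synonymous : ((ν : Valuation) → val ν A₁ ≡ val ν A₂) → Synonymous A₁ A₂
  synonymous same B₁ B₂ r =
    from ⊢-mutual⇔designation (λ ν → Designated-cong (val-replace ν (same ν) r))
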